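{- For every integer $d \ge 5$, $Z_{(3)}(Q_d) = 2^{d-1}$, where $Q_d$ is the $d$-dimensional hypercube.
   Context: $Q_d$ is the $d$-fold Cartesian product $K_2\Box\cdots\Box K_2$ (vertices are binary strings of length $d$, adjacent iff they differ in exactly one coordinate). Let $G=(V,E)$ be a finite simple graph. Color-change rule (zero forcing): given a set of colored vertices, a colored vertex with exactly one uncolored neighbor colors ("forces") that neighbor. Leaks: for a set $L\subseteq V$, placing a leak on each $v\in L$ means attaching to $v$ one new pendant vertex (adjacent only to $v$) which is never initially colored; consequently no vertex of $L$ can ever force a vertex of $V$. A set $S\subseteq V$ is an $\ell$-forcing set if for every $L\subseteq V$ with $|L|\le \ell$, starting with exactly the vertices of $S$ colored and repeatedly applying the color-change rule in the graph with leaks on $L$, every vertex of $V$ eventually becomes colored. $Z_{(\ell)}(G)$ is the minimum size of an $\ell$-forcing set. -}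

module Defs where

open import Data.Nat using (ℕ; zero; suc; _≤_; _+_)
open import Data.Bool using (Bool; true; false; if_then_else_)
open import Data.Bool.Properties using () renaming (_≟_ to _≟B_)
open import Data.Vec using (Vec; []; _∷_)
open import Data.List using (List; length)
open import Data.List.Membership.Propositional using (_∈_)
open import Data.List.Relation.Unary.Unique.Propositional using (Unique)
open import Data.Product using (Σ; _×_)
open import Relation.Binary.PropositionalEquality using (_≡_; _≢_)
open import Relation.Nullary using (¬_; does)

record Graph : Set₁ where
  field
    V   : Set
    Adj : V → V → Set
open Graph public

hamming : ∀ {d} → Vec Bool d → Vec Bool d → ℕ
hamming [] [] = 0
hamming (x ∷ xs) (y ∷ ys) = (if does (x ≟B y) then 0 else 1) + hamming xs ys

Q : ℕ → Graph
Q d = record { V = Vec Bool d ; Adj = λ u v → hamming u v ≡ 1 }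

-- A vertex u forces v when u is colored, u has
-- no leak (a leak is an uncolored pendant neighbour, so a leaked vertex never
-- has v as its unique uncolored neighbour), v is adjacent to u, and every
-- other neighbour of u in G is colored.
data Colored (G : Graph) (L S : List (V G)) : V G → Set where
  initial : ∀ {v} → v ∈ S → Colored G L S v
  force   : ∀ {u v} → Adj G u v → ¬ (u ∈ L) → Colored G L S u →
            (∀ w → Adj G u w → w ≢ v → Colored G L S w) →
            Colored G L S v

IsLeakyForcingSet : (G : Graph) → ℕ → List (V G) → Set
IsLeakyForcingSet G ℓ S =
  ∀ (L : List (V G)) → length L ≤ ℓ → ∀ v → Colored G L S v

LeakyZeroForcingNumber≡ : (G : Graph) → ℕ → ℕ → Set
LeakyZeroForcingNumber≡ G ℓ N =
  Σ (List (V G)) (λ S → Unique S × length S ≡ N × IsLeakyForcingSet G ℓ S)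
  × (∀ (S : List (V G)) → Unique S → IsLeakyForcingSet G ℓ S → N ≤ length S)

module Submission where

-- Over GF(2) the adjacency matrix A of Q_d satisfies A² = d·I, so every function
-- g on the lower half Q_(d-1) extends (uniquely) to an eigenvector h = (g, A g + d g) of A for
-- the eigenvalue d; this eigenspace has 2^(2^(d-1)) elements. If h vanishes on a zero forcing set
-- S then it vanishes everywhere: when u forces v, (A h)(u) = d h(u) reduces to h(v) = 0. So
-- restriction to S is injective on the eigenspace, and |S| ≥ 2^(d-1) even without leaks.
--
-- Take S = the lower half. Each leak-free lower vertex forces the vertex above it,
-- so at most 3 - t upper vertices U stay uncolored, t being the number of upper leaks. Since the
-- upper half has d - 1 ≥ 4 coordinates, a union bound over the at most two other points of U and
-- the leaks (or, for three mutually close points of U, the perimeter of the triangle they form)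
-- yields x ∈ U and a coordinate on which x agrees with every point of U within distance 2 and every
-- upper leak within distance 1. Flipping it gives a colored, leak-free neighbour of x whose only
-- uncolored neighbour is x, which therefore gets forced; repeat until U is empty.

open import Defs
open import Algebra.Bundles using (CommutativeRing)
open import Data.Bool using (Bool; true; false; not; _xor_; _∧_)
open import Data.Bool.Properties
  using ( not-involutive; not-¬; ¬-not; xor-comm; xor-same; xor-identityʳ; ∧-zeroʳ; ∧-distribˡ-xor
        ; xor-∧-commutativeRing)
  renaming (_≟_ to _≟B_)
open import Algebra.Properties.CommutativeSemigroup
  (CommutativeRing.+-commutativeSemigroup xor-∧-commutativeRing) using (interchange)
open import Data.Empty using (⊥-elim)
open import Data.Fin using (Fin; zero; suc)
open import Data.List using (List; []; _∷_; [_]; _++_; length; map; filter)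
open import Data.List.Membership.Propositional using (_∈_; _∉_)
open import Data.List.Membership.Propositional.Properties
  using (∈-map⁺; ∈-map⁻; ∈-++⁺ˡ; ∈-++⁺ʳ; ∈-filter⁺)
open import Data.List.Properties using (length-map; length-++; length-filter; filter-notAll; map-++)
open import Data.List.Relation.Binary.Subset.Propositional using (_⊆_)
open import Data.List.Relation.Unary.All as All using (All; all?)
open import Data.List.Relation.Unary.All.Properties using (¬All⇒Any¬; map⁻)
open import Data.List.Relation.Unary.Any as Any using (Any; here; there)
open import Data.List.Relation.Unary.Unique.Propositional using (Unique)
import Data.List.Relation.Unary.AllPairs as AllPairs
import Data.List.Relation.Unary.Unique.Propositional.Properties as Unique
open import Data.Nat using (ℕ; zero; suc; _+_; _*_; _∸_; _^_; _≤_; _<_; z≤n; s≤s; _≤?_)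
open import Data.Nat.ListAction using (sum)
open import Data.Nat.ListAction.Properties using (sum-++)
open import Data.Nat.Properties
open import Data.Nat.Tactic.RingSolver using (solve-∀)
open import Data.Product as Product using (_×_; _,_; ∃-syntax)
open import Data.Vec using (Vec; []; _∷_; lookup; head; tail; take; drop; _[_]%=_)
  renaming (_++_ to _++ᵛ_)
open import Data.Vec.Properties using (take++drop≡id; ∷-injectiveˡ; ∷-injectiveʳ; ≡-dec)
open import Function using (_∘_; id)
open import Function.Definitions using (Injective)
open import Relation.Binary.Definitions using (DecidableEquality)
open import Relation.Binary.PropositionalEquality hiding ([_])
open import Relation.Nullary using (¬_; Dec; yes; no; ¬?; _×-dec_)

_≟V_ : ∀ {n} → DecidableEquality (Vec Bool n)
_≟V_ = ≡-dec _≟B_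

hamming-refl : ∀ {d} (x : Vec Bool d) → hamming x x ≡ 0
hamming-refl [] = refl
hamming-refl (false ∷ x) = hamming-refl x
hamming-refl (true ∷ x) = hamming-refl x

hamming≡0⇒≡ : ∀ {d} {x y : Vec Bool d} → hamming x y ≡ 0 → x ≡ y
hamming≡0⇒≡ {x = []} {[]} _ = refl
hamming≡0⇒≡ {x = false ∷ x} {false ∷ y} e = cong (false ∷_) (hamming≡0⇒≡ e)
hamming≡0⇒≡ {x = true ∷ x} {true ∷ y} e = cong (true ∷_) (hamming≡0⇒≡ e)

hamming-sym : ∀ {d} (x y : Vec Bool d) → hamming x y ≡ hamming y x
hamming-sym [] [] = refl
hamming-sym (false ∷ x) (false ∷ y) = hamming-sym x y
hamming-sym (true ∷ x) (true ∷ y) = hamming-sym x y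
hamming-sym (false ∷ x) (true ∷ y) = cong suc (hamming-sym x y)
hamming-sym (true ∷ x) (false ∷ y) = cong suc (hamming-sym x y)

hamming-∷ : ∀ {d} b (x y : Vec Bool d) → hamming (b ∷ x) (b ∷ y) ≡ hamming x y
hamming-∷ false x y = refl
hamming-∷ true x y = refl

hamming-∷-not : ∀ {d} b (x : Vec Bool d) → hamming (b ∷ x) (not b ∷ x) ≡ 1
hamming-∷-not false x = cong suc (hamming-refl x)
hamming-∷-not true x = cong suc (hamming-refl x)

hamming-∷-≢ : ∀ {d} {b c} (x y : Vec Bool d) → c ≢ b → hamming (b ∷ x) (c ∷ y) ≡ suc (hamming x y)
hamming-∷-≢ {b = false} {false} x y c≢b = ⊥-elim (c≢b refl)
hamming-∷-≢ {b = false} {true} x y _ = refl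
hamming-∷-≢ {b = true} {false} x y _ = refl
hamming-∷-≢ {b = true} {true} x y c≢b = ⊥-elim (c≢b refl)

-- The GF(2) eigenspace bound

parity : ℕ → Bool
parity zero = false
parity (suc n) = not (parity n)

adjSum : ∀ d → (Vec Bool d → Bool) → Vec Bool d → Bool
adjSum zero h [] = false
adjSum (suc d) h (b ∷ x) = h (not b ∷ x) xor adjSum d (λ y → h (b ∷ y)) x

xor-cancel-middle : ∀ a x c → (a xor x) xor (x xor c) ≡ a xor c
xor-cancel-middle false false c = refl
xor-cancel-middle false true c = not-involutive c
xor-cancel-middle true false c = refl
xor-cancel-middle true true c = refl

xor-cancel-outer : ∀ b c → (b xor c) xor b ≡ c
xor-cancel-outer false c = xor-identityʳ c
xor-cancel-outer true false = refl
xor-cancel-outer true true = refl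

xor-∧-self : ∀ p a → a xor (p ∧ a) ≡ not p ∧ a
xor-∧-self false a = xor-identityʳ a
xor-∧-self true a = xor-same a

xor≡false⇒≡ : ∀ {a b} → a xor b ≡ false → a ≡ b
xor≡false⇒≡ {false} {false} _ = refl
xor≡false⇒≡ {true} {true} _ = refl

adjSum-xor : ∀ d (h₁ h₂ : Vec Bool d → Bool) x →
             adjSum d (λ y → h₁ y xor h₂ y) x ≡ adjSum d h₁ x xor adjSum d h₂ x
adjSum-xor zero h₁ h₂ [] = refl
adjSum-xor (suc d) h₁ h₂ (b ∷ x) =
  trans (cong ((h₁ (not b ∷ x) xor h₂ (not b ∷ x)) xor_)
              (adjSum-xor d (λ y → h₁ (b ∷ y)) (λ y → h₂ (b ∷ y)) x))
        (interchange (h₁ (not b ∷ x)) (h₂ (not b ∷ x)) _ _)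

adjSum-∧ : ∀ d c (h : Vec Bool d → Bool) x → adjSum d (λ y → c ∧ h y) x ≡ c ∧ adjSum d h x
adjSum-∧ zero c h [] = sym (∧-zeroʳ c)
adjSum-∧ (suc d) c h (b ∷ x) =
  trans (cong ((c ∧ h (not b ∷ x)) xor_) (adjSum-∧ d c (λ y → h (b ∷ y)) x))
        (sym (∧-distribˡ-xor c (h (not b ∷ x)) _))

adjSum² : ∀ d (h : Vec Bool d → Bool) x → adjSum d (adjSum d h) x ≡ parity d ∧ h x
adjSum² zero h [] = refl
adjSum² (suc d) h (b ∷ x) = begin
    (h (not (not b) ∷ x) xor X) xor adjSum d (λ y → h (not b ∷ y) xor adjSum d hᵇ y) x
  ≡⟨ cong₂ _xor_ (cong (λ c → h (c ∷ x) xor X) (not-involutive b)) (adjSum-xor d _ _ x) ⟩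
    (h (b ∷ x) xor X) xor (X xor adjSum d (adjSum d hᵇ) x)
  ≡⟨ cong (λ t → (h (b ∷ x) xor X) xor (X xor t)) (adjSum² d hᵇ x) ⟩
    (h (b ∷ x) xor X) xor (X xor (parity d ∧ h (b ∷ x)))
  ≡⟨ xor-cancel-middle (h (b ∷ x)) X _ ⟩
    h (b ∷ x) xor (parity d ∧ h (b ∷ x))
  ≡⟨ xor-∧-self (parity d) _ ⟩
    not (parity d) ∧ h (b ∷ x)
  ∎
  where
    open ≡-Reasoning
    hᵇ : Vec Bool d → Bool
    hᵇ y = h (b ∷ y)
    X : Bool
    X = adjSum d (λ y → h (not b ∷ y)) x

InEigenspace : ∀ d → (Vec Bool d → Bool) → Set
InEigenspace d h = ∀ u → adjSum d h u ≡ parity d ∧ h u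

eigenspace-xor : ∀ {d} {h₁ h₂ : Vec Bool d → Bool} → InEigenspace d h₁ → InEigenspace d h₂ →
                 InEigenspace d (λ u → h₁ u xor h₂ u)
eigenspace-xor {d} {h₁} {h₂} e₁ e₂ u = begin
  adjSum d (λ y → h₁ y xor h₂ y) u       ≡⟨ adjSum-xor d h₁ h₂ u ⟩
  adjSum d h₁ u xor adjSum d h₂ u         ≡⟨ cong₂ _xor_ (e₁ u) (e₂ u) ⟩
  (parity d ∧ h₁ u) xor (parity d ∧ h₂ u) ≡⟨ ∧-distribˡ-xor (parity d) _ _ ⟨
  parity d ∧ (h₁ u xor h₂ u)              ∎
  where open ≡-Reasoning

-- The first block row of [[A, I], [I, A]] (g, h) = (m + 1) (g, h) forces h = A g + (m + 1) g.
extend : ∀ m → (Vec Bool m → Bool) → Vec Bool (suc m) → Bool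
extend m g (false ∷ x) = g x
extend m g (true ∷ x) = adjSum m g x xor (parity (suc m) ∧ g x)

extend-inEigenspace : ∀ m (g : Vec Bool m → Bool) → InEigenspace (suc m) (extend m g)
extend-inEigenspace m g (false ∷ x) = xor-cancel-outer (adjSum m g x) _
extend-inEigenspace m g (true ∷ x) = begin
    g x xor adjSum m (λ y → adjSum m g y xor (p′ ∧ g y)) x
  ≡⟨ cong (g x xor_) (adjSum-xor m (adjSum m g) (λ y → p′ ∧ g y) x) ⟩
    g x xor (adjSum m (adjSum m g) x xor adjSum m (λ y → p′ ∧ g y) x)
  ≡⟨ cong (g x xor_) (cong₂ _xor_ (adjSum² m g x) (adjSum-∧ m p′ g x)) ⟩
    g x xor ((parity m ∧ g x) xor (p′ ∧ adjSum m g x))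
  ≡⟨ rearrange (parity m) (g x) (adjSum m g x) ⟩
    p′ ∧ (adjSum m g x xor (p′ ∧ g x))
  ∎
  where
    open ≡-Reasoning
    p′ : Bool
    p′ = parity (suc m)
    rearrange : ∀ p a s → a xor ((p ∧ a) xor (not p ∧ s)) ≡ not p ∧ (s xor (not p ∧ a))
    rearrange false a s = xor-comm a s
    rearrange true false s = refl
    rearrange true true s = refl

adjSum-vanishing : ∀ d (h : Vec Bool d → Bool) u → (∀ w → hamming u w ≡ 1 → h w ≡ false) →
                   adjSum d h u ≡ false
adjSum-vanishing zero h [] _ = refl
adjSum-vanishing (suc d) h (b ∷ x) h≡0 =
  cong₂ _xor_ (h≡0 (not b ∷ x) (hamming-∷-not b x))
              (adjSum-vanishing d _ x (λ w xw → h≡0 (b ∷ w) (trans (hamming-∷ b x w) xw)))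

adjSum-single : ∀ d (h : Vec Bool d → Bool) {u v} → hamming u v ≡ 1 →
                (∀ w → hamming u w ≡ 1 → w ≢ v → h w ≡ false) → adjSum d h u ≡ h v
adjSum-single zero h {[]} {[]} ()
adjSum-single (suc d) h {b ∷ x} {c ∷ y} uv h≡0 with c ≟B b
... | yes refl =
  cong₂ _xor_ (h≡0 (not b ∷ x) (hamming-∷-not b x) (λ e → not-¬ refl (sym (∷-injectiveˡ e))))
              (adjSum-single d (λ z → h (b ∷ z)) (trans (sym (hamming-∷ b x y)) uv)
                 (λ w xw w≢y → h≡0 (b ∷ w) (trans (hamming-∷ b x w) xw) (w≢y ∘ ∷-injectiveʳ)))
... | no c≢b =
  trans (cong₂ _xor_ (cong h (cong₂ _∷_ (sym (¬-not c≢b)) x≡y))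
                     (adjSum-vanishing d _ x
                        (λ w xw → h≡0 (b ∷ w) (trans (hamming-∷ b x w) xw) (λ e → c≢b (sym (∷-injectiveˡ e))))))
        (xor-identityʳ (h (c ∷ y)))
  where
    x≡y : x ≡ y
    x≡y = hamming≡0⇒≡ (suc-injective (trans (sym (hamming-∷-≢ x y c≢b)) uv))

eigenvector-vanishes : ∀ {d L S} {h : Vec Bool d → Bool} → InEigenspace d h →
                       (∀ {s} → s ∈ S → h s ≡ false) → ∀ {v} → Colored (Q d) L S v → h v ≡ false
eigenvector-vanishes eig h|S (initial s∈S) = h|S s∈S
eigenvector-vanishes {d} {h = h} eig h|S (force {u} {v} uv _ u-colored others-colored) = begin
  h v              ≡⟨ adjSum-single d h uv (λ w uw w≢v →
                        eigenvector-vanishes eig h|S (others-colored w uw w≢v)) ⟨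
  adjSum d h u     ≡⟨ eig u ⟩
  parity d ∧ h u   ≡⟨ cong (parity d ∧_) (eigenvector-vanishes eig h|S u-colored) ⟩
  parity d ∧ false ≡⟨ ∧-zeroʳ (parity d) ⟩
  false            ∎
  where open ≡-Reasoning

allVecs : ∀ n → List (Vec Bool n)
allVecs zero = [ [] ]
allVecs (suc n) = map (false ∷_) (allVecs n) ++ map (true ∷_) (allVecs n)

length-allVecs : ∀ n → length (allVecs n) ≡ 2 ^ n
length-allVecs zero = refl
length-allVecs (suc n) = begin
  length (map (false ∷_) (allVecs n) ++ map (true ∷_) (allVecs n))
    ≡⟨ length-++ (map (false ∷_) (allVecs n)) ⟩
  length (map (false ∷_) (allVecs n)) + length (map (true ∷_) (allVecs n))
    ≡⟨ cong₂ _+_ (length-map _ (allVecs n)) (length-map _ (allVecs n)) ⟩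
  length (allVecs n) + length (allVecs n)
    ≡⟨ cong₂ _+_ (length-allVecs n) (trans (length-allVecs n) (sym (+-identityʳ _))) ⟩
  2 ^ suc n ∎
  where open ≡-Reasoning

∈-allVecs : ∀ {n} (x : Vec Bool n) → x ∈ allVecs n
∈-allVecs [] = here refl
∈-allVecs {suc n} (false ∷ x) = ∈-++⁺ˡ (∈-map⁺ (false ∷_) (∈-allVecs x))
∈-allVecs {suc n} (true ∷ x) = ∈-++⁺ʳ (map (false ∷_) (allVecs n)) (∈-map⁺ (true ∷_) (∈-allVecs x))

allVecs-unique : ∀ n → Unique (allVecs n)
allVecs-unique zero = All.[] AllPairs.∷ AllPairs.[]
allVecs-unique (suc n) =
  Unique.++⁺ (Unique.map⁺ ∷-injectiveʳ (allVecs-unique n)) (Unique.map⁺ ∷-injectiveʳ (allVecs-unique n))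
             disjoint
  where
    disjoint : ∀ {v} → ¬ (v ∈ map (false ∷_) (allVecs n) × v ∈ map (true ∷_) (allVecs n))
    disjoint (p , q) with ∈-map⁻ (false ∷_) p | ∈-map⁻ (true ∷_) q
    ... | _ , _ , refl | _ , _ , ()

unique-⊆⇒length≤ : ∀ {A : Set} → DecidableEquality A → {xs ys : List A} → Unique xs → xs ⊆ ys →
                   length xs ≤ length ys
unique-⊆⇒length≤ _≟_ {[]} _ _ = z≤n
unique-⊆⇒length≤ _≟_ {x ∷ xs} {ys} (x∉xs AllPairs.∷ xs-unique) xs⊆ys =
  ≤-trans (s≤s (unique-⊆⇒length≤ _≟_ xs-unique xs⊆ys-x))
          (filter-notAll ≢x? ys (Any.map (λ x≡y y≢x → y≢x (sym x≡y)) (xs⊆ys (here refl))))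
  where
    ≢x? : ∀ y → Dec (y ≢ x)
    ≢x? y = ¬? (y ≟ x)
    xs⊆ys-x : xs ⊆ filter ≢x? ys
    xs⊆ys-x z∈xs = ∈-filter⁺ ≢x? (xs⊆ys (there z∈xs)) (λ z≡x → All.lookup x∉xs z∈xs (sym z≡x))

injective⇒dimension≤ : ∀ {N k} (f : Vec Bool N → Vec Bool k) → Injective _≡_ _≡_ f → N ≤ k
injective⇒dimension≤ {N} {k} f f-injective with N ≤? k
... | yes N≤k = N≤k
... | no N≰k = ⊥-elim (<⇒≱ (^-monoʳ-< 2 (s≤s (s≤s z≤n)) (≰⇒> N≰k)) 2^N≤2^k)
  where
    2^N≤2^k : 2 ^ N ≤ 2 ^ k
    2^N≤2^k = begin
      2 ^ N                   ≡⟨ length-allVecs N ⟨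
      length (allVecs N)      ≡⟨ length-map f (allVecs N) ⟨
      length (map f (allVecs N))
        ≤⟨ unique-⊆⇒length≤ _≟V_ (Unique.map⁺ f-injective (allVecs-unique N)) (λ {x} _ → ∈-allVecs x) ⟩
      length (allVecs k)      ≡⟨ length-allVecs k ⟩
      2 ^ k                   ∎
      where open ≤-Reasoning

evalTable : ∀ m → Vec Bool (2 ^ m) → Vec Bool m → Bool
evalTable zero (a ∷ []) [] = a
evalTable (suc m) t (false ∷ x) = evalTable m (take (2 ^ m) t) x
evalTable (suc m) t (true ∷ x) = evalTable m (take (2 ^ m) (drop (2 ^ m) t)) x

halves-≡ : ∀ {A : Set} n {t t′ : Vec A (n + (n + 0))} → take n t ≡ take n t′ →
           take n (drop n t) ≡ take n (drop n t′) → t ≡ t′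
halves-≡ n {t} {t′} first second = begin
  t                                                   ≡⟨ take++drop≡id n t ⟨
  take n t ++ᵛ drop n t                               ≡⟨ cong₂ _++ᵛ_ first rest ⟩
  take n t′ ++ᵛ drop n t′                             ≡⟨ take++drop≡id n t′ ⟩
  t′                                                  ∎
  where
    open ≡-Reasoning
    rest : drop n t ≡ drop n t′
    rest = begin
      drop n t                                        ≡⟨ take++drop≡id n (drop n t) ⟨
      take n (drop n t) ++ᵛ drop n (drop n t)         ≡⟨ cong₂ _++ᵛ_ second (empty _ _) ⟩
      take n (drop n t′) ++ᵛ drop n (drop n t′)       ≡⟨ take++drop≡id n (drop n t′) ⟩
      drop n t′                                       ∎
      where
        empty : ∀ {A : Set} (u v : Vec A 0) → u ≡ v
        empty [] [] = refl

evalTable-injective : ∀ m {t t′ : Vec Bool (2 ^ m)} → (∀ x → evalTable m t x ≡ evalTable m t′ x) →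
                      t ≡ t′
evalTable-injective zero {a ∷ []} {a′ ∷ []} same = cong (_∷ []) (same [])
evalTable-injective (suc m) same =
  halves-≡ (2 ^ m) (evalTable-injective m (λ x → same (false ∷ x)))
                   (evalTable-injective m (λ x → same (true ∷ x)))

restrict : ∀ {d} → (Vec Bool d → Bool) → (S : List (Vec Bool d)) → Vec Bool (length S)
restrict h [] = []
restrict h (s ∷ S) = h s ∷ restrict h S

restrict-≡ : ∀ {d} {f g : Vec Bool d → Bool} S → restrict f S ≡ restrict g S →
             ∀ {s} → s ∈ S → f s ≡ g s
restrict-≡ (s ∷ S) e (here refl) = ∷-injectiveˡ e
restrict-≡ (s ∷ S) e (there s∈S) = restrict-≡ S (∷-injectiveʳ e) s∈S

forcingSet-size≥ : ∀ m {L} (S : List (Vec Bool (suc m))) → (∀ v → Colored (Q (suc m)) L S v) →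
                   2 ^ m ≤ length S
forcingSet-size≥ m S forces = injective⇒dimension≤ (λ t → restrict (eigenvector t) S) restriction-injective
  where
    eigenvector : Vec Bool (2 ^ m) → Vec Bool (suc m) → Bool
    eigenvector t = extend m (evalTable m t)
    restriction-injective : Injective _≡_ _≡_ (λ t → restrict (eigenvector t) S)
    restriction-injective {t} {t′} same-on-S =
      evalTable-injective m (λ x →
        xor≡false⇒≡ (eigenvector-vanishes difference-eigen difference|S (forces (false ∷ x))))
      where
        difference-eigen : InEigenspace (suc m) (λ u → eigenvector t u xor eigenvector t′ u)
        difference-eigen = eigenspace-xor (extend-inEigenspace m _) (extend-inEigenspace m _)
        difference|S : ∀ {s} → s ∈ S → eigenvector t s xor eigenvector t′ s ≡ false
        difference|S {s} s∈S =
          trans (cong (_xor eigenvector t′ s) (restrict-≡ S same-on-S s∈S)) (xor-same (eigenvector t′ s))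

-- Forcing the upper half

hamming-%=not : ∀ {m} (i : Fin m) (x : Vec Bool m) → hamming x (x [ i ]%= not) ≡ 1
hamming-%=not zero (b ∷ x) = hamming-∷-not b x
hamming-%=not (suc i) (b ∷ x) = trans (hamming-∷ b x _) (hamming-%=not i x)

hamming-%=not-agreeing : ∀ {m} (i : Fin m) (x w : Vec Bool m) → lookup x i ≡ lookup w i →
                         hamming (x [ i ]%= not) w ≡ suc (hamming x w)
hamming-%=not-agreeing zero (false ∷ x) (.false ∷ w) refl = refl
hamming-%=not-agreeing zero (true ∷ x) (.true ∷ w) refl = refl
hamming-%=not-agreeing (suc i) (false ∷ x) (false ∷ w) e = hamming-%=not-agreeing i x w e
hamming-%=not-agreeing (suc i) (true ∷ x) (true ∷ w) e = hamming-%=not-agreeing i x w e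
hamming-%=not-agreeing (suc i) (false ∷ x) (true ∷ w) e = cong suc (hamming-%=not-agreeing i x w e)
hamming-%=not-agreeing (suc i) (true ∷ x) (false ∷ w) e = cong suc (hamming-%=not-agreeing i x w e)

hamming≤suc-hamming-%=not : ∀ {m} (i : Fin m) (x w : Vec Bool m) →
                             hamming x w ≤ suc (hamming (x [ i ]%= not) w)
hamming≤suc-hamming-%=not zero (false ∷ x) (false ∷ w) = ≤-trans (n≤1+n _) (n≤1+n _)
hamming≤suc-hamming-%=not zero (true ∷ x) (true ∷ w) = ≤-trans (n≤1+n _) (n≤1+n _)
hamming≤suc-hamming-%=not zero (false ∷ x) (true ∷ w) = ≤-refl
hamming≤suc-hamming-%=not zero (true ∷ x) (false ∷ w) = ≤-refl
hamming≤suc-hamming-%=not (suc i) (false ∷ x) (false ∷ w) = hamming≤suc-hamming-%=not i x w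
hamming≤suc-hamming-%=not (suc i) (true ∷ x) (true ∷ w) = hamming≤suc-hamming-%=not i x w
hamming≤suc-hamming-%=not (suc i) (false ∷ x) (true ∷ w) = s≤s (hamming≤suc-hamming-%=not i x w)
hamming≤suc-hamming-%=not (suc i) (true ∷ x) (false ∷ w) = s≤s (hamming≤suc-hamming-%=not i x w)

AgreeIfWithin : ∀ {m} → ℕ → Fin m → Vec Bool m → Vec Bool m → Set
AgreeIfWithin t i x w = hamming x w ≤ t → lookup x i ≡ lookup w i

%=not-≢ : ∀ {m} {i : Fin m} {x w} → AgreeIfWithin 1 i x w → x [ i ]%= not ≢ w
%=not-≢ {i = i} {x} agree refl =
  0≢1+n (trans (sym (hamming-refl y)) (hamming-%=not-agreeing i x y (agree (≤-reflexive (hamming-%=not i x)))))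
  where y = x [ i ]%= not

%=not-nonadjacent : ∀ {m} {i : Fin m} {x w} → AgreeIfWithin 2 i x w → hamming (x [ i ]%= not) w ≡ 1 → x ≡ w
%=not-nonadjacent {i = i} {x} {w} agree adjacent with hamming x w ≤? 2
... | yes near = hamming≡0⇒≡ (suc-injective (trans (sym (hamming-%=not-agreeing i x w (agree near))) adjacent))
... | no far = ⊥-elim (far (≤-trans (hamming≤suc-hamming-%=not i x w) (≤-reflexive (cong suc adjacent))))

-- With U the uncolored and P the leaky vertices of a layer, the forcer is a colored,
-- leak-free neighbour of the target whose only uncolored neighbour is the target.
record ForcingMove {m} (U P : List (Vec Bool m)) : Set where
  field
    target                  : Vec Bool m
    target∈U                : target ∈ U
    coordinate              : Fin m
    forcer∉P                : target [ coordinate ]%= not ∉ P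
    forcer∉U                : target [ coordinate ]%= not ∉ U
    forcer-sees-only-target : ∀ {u} → u ∈ U → hamming (target [ coordinate ]%= not) u ≡ 1 → target ≡ u

forcingMove-from-agreement : ∀ {m} {U P : List (Vec Bool m)} {x} i → x ∈ U →
                             (∀ {u} → u ∈ U → AgreeIfWithin 2 i x u) →
                             (∀ {p} → p ∈ P → AgreeIfWithin 1 i x p) → ForcingMove U P
forcingMove-from-agreement {x = x} i x∈U agreeU agreeP = record
  { target                  = x
  ; target∈U                = x∈U
  ; coordinate              = i
  ; forcer∉P                = λ y∈P → %=not-≢ {i = i} {x} (agreeP y∈P) refl
  ; forcer∉U                = λ y∈U → %=not-≢ {i = i} {x} (λ near → agreeU y∈U (≤-trans near (n≤1+n 1))) refl
  ; forcer-sees-only-target = λ u∈U → %=not-nonadjacent {i = i} {x} (agreeU u∈U)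
  }

-- Replacing far points by x itself keeps them out of the union bound below.
nearby : ∀ {m} → ℕ → Vec Bool m → Vec Bool m → Vec Bool m
nearby t x w with hamming x w ≤? t
... | yes _ = w
... | no _ = x

hamming-nearby≤ : ∀ {m} t (x w : Vec Bool m) → hamming x (nearby t x w) ≤ t
hamming-nearby≤ t x w with hamming x w ≤? t
... | yes near = near
... | no _ = ≤-trans (≤-reflexive (hamming-refl x)) z≤n

hamming-nearby-far : ∀ {m} t (x w : Vec Bool m) → t < hamming x w → hamming x (nearby t x w) ≡ 0
hamming-nearby-far t x w far with hamming x w ≤? t
... | yes near = ⊥-elim (<⇒≱ far near)
... | no _ = hamming-refl x

hamming-nearby-self : ∀ {m} t (x : Vec Bool m) → hamming x (nearby t x x) ≡ 0
hamming-nearby-self t x with hamming x x ≤? t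
... | yes _ = hamming-refl x
... | no _ = hamming-refl x

nearby-agree : ∀ {m} t i (x w : Vec Bool m) → lookup x i ≡ lookup (nearby t x w) i → AgreeIfWithin t i x w
nearby-agree t i x w e with hamming x w ≤? t
... | yes _ = λ _ → e
... | no far = λ near → ⊥-elim (far near)

nearbyDistance : ∀ {m} → ℕ → Vec Bool m → List (Vec Bool m) → ℕ
nearbyDistance t x ws = sum (map (hamming x) (map (nearby t x) ws))

nearbyDistance≤ : ∀ {m} t (x : Vec Bool m) ws → nearbyDistance t x ws ≤ t * length ws
nearbyDistance≤ t x [] = ≤-reflexive (sym (*-zeroʳ t))
nearbyDistance≤ t x (w ∷ ws) =
  ≤-trans (+-mono-≤ (hamming-nearby≤ t x w) (nearbyDistance≤ t x ws)) (≤-reflexive (sym (*-suc t _)))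

sum-hamming-tail≤ : ∀ {m} b (x : Vec Bool m) ws →
                    sum (map (hamming x) (map tail ws)) ≤ sum (map (hamming (b ∷ x)) ws)
sum-hamming-tail≤ b x [] = z≤n
sum-hamming-tail≤ b x ((c ∷ w) ∷ ws) = +-mono-≤ (m≤n+m (hamming x w) _) (sum-hamming-tail≤ b x ws)

sum-hamming-tail< : ∀ {m} b (x : Vec Bool m) ws → Any (λ w → ¬ head w ≡ b) ws →
                    sum (map (hamming x) (map tail ws)) < sum (map (hamming (b ∷ x)) ws)
sum-hamming-tail< b x ((c ∷ w) ∷ ws) (here c≢b) =
  +-mono-≤ (≤-reflexive (sym (hamming-∷-≢ x w c≢b))) (sum-hamming-tail≤ b x ws)
sum-hamming-tail< b x ((c ∷ w) ∷ ws) (there disagree) =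
  ≤-trans (≤-reflexive (sym (+-suc (hamming x w) _)))
          (+-mono-≤ (m≤n+m (hamming x w) _) (sum-hamming-tail< b x ws disagree))

agreeing-coordinate : ∀ {m} (x : Vec Bool m) (ws : List (Vec Bool m)) → sum (map (hamming x) ws) < m →
                      ∃[ i ] All (λ w → lookup x i ≡ lookup w i) ws
agreeing-coordinate (b ∷ x) ws bound with all? (λ w → head w ≟B b) ws
... | yes heads≡b = zero , All.map (λ { {_ ∷ _} refl → refl }) heads≡b
... | no heads≢b =
  let i , agree = agreeing-coordinate x (map tail ws) tails-bound
  in suc i , All.map (λ { {_ ∷ _} e → e }) (map⁻ agree)
  where
    tails-bound : sum (map (hamming x) (map tail ws)) < _
    tails-bound = ≤-trans (sum-hamming-tail< b x ws (¬All⇒Any¬ (λ w → head w ≟B b) ws heads≢b)) (≤-pred bound)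

private
  odd-first : ∀ h₁ h₂ h₃ → 2 + (h₁ + h₂ + h₃) ≡ suc h₁ + suc h₂ + h₃
  odd-first = solve-∀
  odd-second : ∀ h₁ h₂ h₃ → 2 + (h₁ + h₂ + h₃) ≡ suc h₁ + h₂ + suc h₃
  odd-second = solve-∀
  odd-third : ∀ h₁ h₂ h₃ → 2 + (h₁ + h₂ + h₃) ≡ h₁ + suc h₂ + suc h₃
  odd-third = solve-∀

perimeter : ∀ {m} → Vec Bool m → Vec Bool m → Vec Bool m → ℕ
perimeter a b c = hamming a b + hamming a c + hamming b c

perimeter-∷ : ∀ {m} {x y z} (a b c : Vec Bool m) → ¬ (x ≡ y × x ≡ z) →
              2 + perimeter a b c ≤ perimeter (x ∷ a) (y ∷ b) (z ∷ c)
perimeter-∷ {x = false} {false} {false} _ _ _ not-all = ⊥-elim (not-all (refl , refl))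
perimeter-∷ {x = true} {true} {true} _ _ _ not-all = ⊥-elim (not-all (refl , refl))
perimeter-∷ {x = false} {false} {true} a b c _ = ≤-reflexive (odd-third (hamming a b) (hamming a c) (hamming b c))
perimeter-∷ {x = true} {true} {false} a b c _ = ≤-reflexive (odd-third (hamming a b) (hamming a c) (hamming b c))
perimeter-∷ {x = false} {true} {false} a b c _ = ≤-reflexive (odd-second (hamming a b) (hamming a c) (hamming b c))
perimeter-∷ {x = true} {false} {true} a b c _ = ≤-reflexive (odd-second (hamming a b) (hamming a c) (hamming b c))
perimeter-∷ {x = false} {true} {true} a b c _ = ≤-reflexive (odd-first (hamming a b) (hamming a c) (hamming b c))
perimeter-∷ {x = true} {false} {false} a b c _ = ≤-reflexive (odd-first (hamming a b) (hamming a c) (hamming b c))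

common-coordinate₃ : ∀ {m} (a b c : Vec Bool m) → perimeter a b c < m + m →
                     ∃[ i ] (lookup a i ≡ lookup b i × lookup a i ≡ lookup c i)
common-coordinate₃ {suc m} (x ∷ a) (y ∷ b) (z ∷ c) bound with (x ≟B y) ×-dec (x ≟B z)
... | yes (refl , refl) = zero , refl , refl
... | no not-all = Product.map suc id (common-coordinate₃ a b c tails-bound)
  where
    tails-bound : perimeter a b c < m + m
    tails-bound = ≤-pred (≤-trans (perimeter-∷ a b c not-all) (≤-trans (≤-pred bound) (≤-reflexive (+-suc m m))))

forcingMove-from-budget : ∀ {m} {U P : List (Vec Bool m)} {x} → x ∈ U →
                          nearbyDistance 2 x U + nearbyDistance 1 x P < m → ForcingMove U P
forcingMove-from-budget {m} {U} {P} {x} x∈U budget =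
  let i , agree = agreeing-coordinate x (near₂ ++ near₁) total in
  forcingMove-from-agreement i x∈U
    (λ u∈U → nearby-agree 2 i x _ (All.lookup agree (∈-++⁺ˡ (∈-map⁺ (nearby 2 x) u∈U))))
    (λ p∈P → nearby-agree 1 i x _ (All.lookup agree (∈-++⁺ʳ near₂ (∈-map⁺ (nearby 1 x) p∈P))))
  where
    near₂ near₁ : List (Vec Bool m)
    near₂ = map (nearby 2 x) U
    near₁ = map (nearby 1 x) P
    total : sum (map (hamming x) (near₂ ++ near₁)) < m
    total = subst (_< m) (sym (trans (cong sum (map-++ (hamming x) near₂ near₁)) (sum-++ (map (hamming x) near₂) _)))
                  budget

module _ {m} (4≤m : 4 ≤ m) where

  private
    within-budget : ∀ {s} → s ≤ 3 → s < m
    within-budget s≤3 = ≤-trans (s≤s s≤3) 4≤m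

    budget-identity : ∀ u p → 2 * u + 1 * p ≡ u + (u + p)
    budget-identity = solve-∀

    within-budget₃ : ∀ {h₁ h₂ h₃ b₁ b₂ b₃} → h₁ ≤ b₁ → h₂ ≤ b₂ → h₃ ≤ b₃ → b₁ + (b₂ + (b₃ + 0)) + 0 ≤ 3 →
                     h₁ + (h₂ + (h₃ + 0)) + 0 < m
    within-budget₃ p₁ p₂ p₃ b≤3 =
      within-budget (≤-trans (+-mono-≤ (+-mono-≤ p₁ (+-mono-≤ p₂ (+-mono-≤ p₃ ≤-refl))) ≤-refl) b≤3)

    self : ∀ (x : Vec Bool m) → hamming x (nearby 2 x x) ≤ 0
    self x = ≤-reflexive (hamming-nearby-self 2 x)

    far : ∀ (x w : Vec Bool m) → ¬ hamming x w ≤ 2 → hamming x (nearby 2 x w) ≤ 0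
    far x w w-far = ≤-reflexive (hamming-nearby-far 2 x w (≰⇒> w-far))

  forcingMove-few : ∀ a (U₀ P : List (Vec Bool m)) → length U₀ ≤ 1 → length (a ∷ U₀) + length P ≤ 3 →
                    ForcingMove (a ∷ U₀) P
  forcingMove-few a U₀ P |U₀|≤1 size = forcingMove-from-budget (here refl) (within-budget (begin
    hamming a (nearby 2 a a) + nearbyDistance 2 a U₀ + nearbyDistance 1 a P
      ≡⟨ cong (λ d → d + nearbyDistance 2 a U₀ + nearbyDistance 1 a P) (hamming-nearby-self 2 a) ⟩
    nearbyDistance 2 a U₀ + nearbyDistance 1 a P
      ≤⟨ +-mono-≤ (nearbyDistance≤ 2 a U₀) (nearbyDistance≤ 1 a P) ⟩
    2 * length U₀ + 1 * length P
      ≡⟨ budget-identity (length U₀) (length P) ⟩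
    length U₀ + (length U₀ + length P)
      ≤⟨ +-mono-≤ |U₀|≤1 (≤-pred size) ⟩
    3 ∎))
    where open ≤-Reasoning

  forcingMove₃ : ∀ (a b c : Vec Bool m) → ForcingMove (a ∷ b ∷ c ∷ []) []
  forcingMove₃ a b c = by-distances (hamming a b ≤? 2) (hamming a c ≤? 2) (hamming b c ≤? 2)
    where
      by-distances : Dec (hamming a b ≤ 2) → Dec (hamming a c ≤ 2) → Dec (hamming b c ≤ 2) →
                     ForcingMove (a ∷ b ∷ c ∷ []) []
      by-distances (no b-far) _ _ =
        forcingMove-from-budget (here refl) (within-budget₃ (self a) (far a b b-far) (hamming-nearby≤ 2 a c) (n≤1+n 2))
      by-distances (yes _) (no c-far) _ =
        forcingMove-from-budget (here refl) (within-budget₃ (self a) (hamming-nearby≤ 2 a b) (far a c c-far) (n≤1+n 2))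
      by-distances (yes _) (yes _) (no c-far-b) =
        forcingMove-from-budget (there (here refl))
          (within-budget₃ (hamming-nearby≤ 2 b a) (self b) (far b c c-far-b) (n≤1+n 2))
      by-distances (yes ab) (yes ac) (yes bc) =
        let i , a≡b , a≡c = common-coordinate₃ a b c
              (≤-trans (s≤s (+-mono-≤ (+-mono-≤ ab ac) bc)) (≤-trans (n≤1+n 7) (+-mono-≤ 4≤m 4≤m)))
            agree : ∀ {u} → u ∈ a ∷ b ∷ c ∷ [] → AgreeIfWithin 2 i a u
            agree = λ { (here refl) _ → refl ; (there (here refl)) _ → a≡b ; (there (there (here refl))) _ → a≡c }
        in forcingMove-from-agreement i (here refl) agree λ ()

  forcingMove : ∀ a (U₀ P : List (Vec Bool m)) → length (a ∷ U₀) + length P ≤ 3 → ForcingMove (a ∷ U₀) P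
  forcingMove a [] P size = forcingMove-few a [] P z≤n size
  forcingMove a (b ∷ []) P size = forcingMove-few a (b ∷ []) P (s≤s z≤n) size
  forcingMove a (b ∷ c ∷ []) [] _ = forcingMove₃ a b c
  forcingMove a (_ ∷ _ ∷ []) (_ ∷ _) (s≤s (s≤s (s≤s ())))
  forcingMove a (_ ∷ _ ∷ _ ∷ _) _ (s≤s (s≤s (s≤s ())))

layer : ∀ {m} → Bool → List (Vec Bool (suc m)) → List (Vec Bool m)
layer b [] = []
layer b ((c ∷ y) ∷ L) with c ≟B b
... | yes _ = y ∷ layer b L
... | no _ = layer b L

∈-layer : ∀ {m b} {y : Vec Bool m} L → (b ∷ y) ∈ L → y ∈ layer b L
∈-layer {b = b} ((c ∷ z) ∷ L) (here refl) with b ≟B b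
... | yes _ = here refl
... | no b≢b = ⊥-elim (b≢b refl)
∈-layer {b = b} ((c ∷ z) ∷ L) (there y∈L) with c ≟B b
... | yes _ = there (∈-layer L y∈L)
... | no _ = ∈-layer L y∈L

length-layers : ∀ {m} (L : List (Vec Bool (suc m))) → length (layer false L) + length (layer true L) ≡ length L
length-layers [] = refl
length-layers ((false ∷ y) ∷ L) = cong suc (length-layers L)
length-layers ((true ∷ y) ∷ L) = trans (+-suc _ _) (cong suc (length-layers L))

lowerHalf : ∀ m → List (Vec Bool (suc m))
lowerHalf m = map (false ∷_) (allVecs m)

lowerHalf-unique : ∀ m → Unique (lowerHalf m)
lowerHalf-unique m = Unique.map⁺ ∷-injectiveʳ (allVecs-unique m)

length-lowerHalf : ∀ m → length (lowerHalf m) ≡ 2 ^ m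
length-lowerHalf m = trans (length-map _ (allVecs m)) (length-allVecs m)

module _ {m} (L : List (Vec Bool (suc m))) where

  private
    Colored↑ : Vec Bool m → Set
    Colored↑ z = Colored (Q (suc m)) L (lowerHalf m) (true ∷ z)

  lowerHalf-colored : ∀ x → Colored (Q (suc m)) L (lowerHalf m) (false ∷ x)
  lowerHalf-colored x = initial (∈-map⁺ (false ∷_) (∈-allVecs x))

  forced-from-below : ∀ {z} → z ∉ layer false L → Colored↑ z
  forced-from-below {z} z∉L = force (cong suc (hamming-refl z)) (z∉L ∘ ∈-layer L) (lowerHalf-colored z) others
    where
      others : ∀ w → hamming (false ∷ z) w ≡ 1 → w ≢ true ∷ z → Colored (Q (suc m)) L (lowerHalf m) w
      others (false ∷ y) _ _ = lowerHalf-colored y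
      others (true ∷ y) zy w≢ = ⊥-elim (w≢ (cong (true ∷_) (sym (hamming≡0⇒≡ (suc-injective zy)))))

  forced-within-upper : 4 ≤ m → ∀ n (U : List (Vec Bool m)) → length U ≤ n →
                        length U + length (layer true L) ≤ 3 → (∀ {z} → z ∉ U → Colored↑ z) → ∀ z → Colored↑ z
  forced-within-upper _ _ [] _ _ colored z = colored λ ()
  forced-within-upper 4≤m (suc n) U@(a ∷ U₀) |U|≤ budget colored =
    forced-within-upper 4≤m n U′ |U′|≤n budget′ colored′
    where
      open ForcingMove (forcingMove 4≤m a U₀ (layer true L) budget)
      x y : Vec Bool m
      x = target
      y = target [ coordinate ]%= not

      neighbours : ∀ w → hamming (true ∷ y) w ≡ 1 → w ≢ true ∷ x → Colored (Q (suc m)) L (lowerHalf m) w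
      neighbours (false ∷ w) _ _ = lowerHalf-colored w
      neighbours (true ∷ w) yw w≢x with Any.any? (w ≟V_) U
      ... | no w∉U = colored w∉U
      ... | yes w∈U = ⊥-elim (w≢x (cong (true ∷_) (sym (forcer-sees-only-target w∈U yw))))

      x-colored : Colored↑ x
      x-colored = force (trans (hamming-sym y x) (hamming-%=not coordinate x)) (forcer∉P ∘ ∈-layer L)
                        (colored forcer∉U) neighbours

      ≢x? : ∀ u → Dec (u ≢ x)
      ≢x? u = ¬? (u ≟V x)

      U′ : List (Vec Bool m)
      U′ = filter ≢x? U

      |U′|≤n : length U′ ≤ n
      |U′|≤n = ≤-pred (≤-trans (filter-notAll ≢x? U (Any.map (λ x≡u u≢x → u≢x (sym x≡u)) target∈U)) |U|≤)

      budget′ : length U′ + length (layer true L) ≤ 3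
      budget′ = ≤-trans (+-monoˡ-≤ _ (length-filter ≢x? U)) budget

      colored′ : ∀ {z} → z ∉ U′ → Colored↑ z
      colored′ {z} z∉U′ with z ≟V x | Any.any? (z ≟V_) U
      ... | yes refl | _ = x-colored
      ... | no z≢x | yes z∈U = ⊥-elim (z∉U′ (∈-filter⁺ ≢x? z∈U z≢x))
      ... | no _ | no z∉U = colored z∉U

  all-colored : 4 ≤ m → length L ≤ 3 → ∀ v → Colored (Q (suc m)) L (lowerHalf m) v
  all-colored _ _ (false ∷ x) = lowerHalf-colored x
  all-colored 4≤m |L|≤3 (true ∷ z) =
    forced-within-upper 4≤m 3 (layer false L) (≤-trans (m≤m+n _ _) budget) budget forced-from-below z
    where
      budget : length (layer false L) + length (layer true L) ≤ 3
      budget = subst (_≤ 3) (sym (length-layers L)) |L|≤3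

proposition24 : ∀ (d : ℕ) → 5 ≤ d → LeakyZeroForcingNumber≡ (Q d) 3 (2 ^ (d ∸ 1))
proposition24 (suc m) (s≤s 4≤m) =
  (lowerHalf m , lowerHalf-unique m , length-lowerHalf m , λ L |L|≤3 → all-colored L 4≤m |L|≤3) ,
  λ S _ S-forces → forcingSet-size≥ m S (S-forces [] z≤n)
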